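{- Let $g = \langle (V,E), v_0, A, \{V_a\}_{a\in A}, (\prec_b)_{b\in A}\rangle$ be a game played on a finite graph, and let $a\in A$ be such that $\prec_a$ is an automatic-piecewise prefix-linear strict weak order with associated equivalence relation $\sim$ on $H$. Let $h\in H$ and $h'\in H$ with $h'\sim h$. Then $\gamma_a(h,s_a)=\gamma_a(h',s_a)$ for every strategy $s_a$ of $a$ in $g_h$, and $\Gamma_a(h)=\Gamma_a(h')$.
   Context: A game played on a finite graph: $(V,E)$ a finite directed graph in which every vertex has an outgoing edge; $A$ a set of players; $\{V_a\}$ pairwise disjoint sets covering $V$; $v_0$ the start vertex; $H$ the finite paths from $v_0$, $[H]$ the infinite ones; preferences $\prec_b\subseteq[H]\times[H]$. For a history ending in a vertex, $hp$ denotes $h$ followed by the continuation sequence $p$. A strict weak order is an irreflexive transitive relation with $\neg(x\prec y)\wedge\neg(y\prec z)\Rightarrow\neg(x\prec z)$. $\prec$ is automatic-piecewise prefix-linear if there is an equivalence relation $\sim$ on $H$ with finitely many classes, decidable by a finite automaton, such that histories ending in different vertices lie in different classes, and $h\sim h'$ implies $hp\prec hq\iff h'p\prec h'q$ for all $p,q$ with $hp,hq,h'p,h'q\in[H]$. For $h\in H$ ending in $v_1$, the future game $g_h$ is played on the same graph from $v_1$; $[H_{g_h}]$ is its set of infinite paths starting at $v_1$; a strategy of $a$ in $g_h$ is a map from finite paths from $v_1$ ending in $V_a$ to successor vertices, and $[H_{g_h}(s_a)]$ is the set of infinite paths from $v_1$ compatible with $s_a$ (so since $h\sim h'$ implies both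 end in $v_1$, a strategy in $g_h$ is also one in $g_{h'}$). The player guarantee is $\gamma_a(h,s_a):=\{v_1p\in[H_{g_h}] \mid \exists v_1p'\in[H_{g_h}(s_a)],\ \neg(hp\prec_a hp')\}$ and the best guarantee is $\Gamma_a(h):=\bigcap_{s_a}\gamma_a(h,s_a)$ over all strategies $s_a$ of $a$ in $g_h$. -}

module Defs where

open import Level using (0ℓ)
open import Data.Nat using (ℕ; zero; suc)
open import Data.Fin using (Fin)
open import Data.List using (List; []; _∷_; foldl; applyUpTo)
open import Data.Product using (Σ; ∃; _×_; _,_; proj₁; proj₂)
open import Data.Unit using (⊤)
open import Relation.Nullary using (¬_)
open import Relation.Binary.PropositionalEquality using (_≡_)
open import Relation.Binary.Structures using (IsEquivalence)
open import Function.Bundles using (_⇔_)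

-- Vertices are Fin n (finite graph);
-- the vertex partition {V_a} is given by an owner function (pairwise
-- disjoint sets covering V); preferences are relations on infinite
-- vertex sequences (only their restriction to [H] matters).
record Game : Set₁ where
  field
    n      : ℕ
    E      : Fin n → Fin n → Set
    total  : ∀ v → ∃ λ w → E v w
    A      : Set
    owner  : Fin n → A
    v₀     : Fin n
    pref   : A → (ℕ → Fin n) → (ℕ → Fin n) → Set   -- pref b x y  means  x ≺_b y

module _ (g : Game) where
  open Game g

  V : Set
  V = Fin n

  Stream : Set
  Stream = ℕ → V

  -- finite path  v ∷ u  (a nonempty list with head v, tail u)
  IsPath : V → List V → Set
  IsPath v []      = ⊤
  IsPath v (w ∷ u) = E v w × IsPath w u

  lastOf : V → List V → V
  lastOf v []      = v
  lastOf v (w ∷ u) = lastOf w u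

  -- H : finite paths from v₀, represented by their tail u (the path is v₀ ∷ u)
  H : Set
  H = Σ (List V) (IsPath v₀)

  lastH : H → V
  lastH h = lastOf v₀ (proj₁ h)

  InfPathFrom : V → Stream → Set
  InfPathFrom v ρ = (ρ 0 ≡ v) × (∀ i → E (ρ i) (ρ (suc i)))

  InfH : Stream → Set
  InfH = InfPathFrom v₀

  _++ₛ_ : List V → Stream → Stream
  ([]    ++ₛ p) i       = p i
  ((x ∷ l) ++ₛ p) zero    = x
  ((x ∷ l) ++ₛ p) (suc i) = (l ++ₛ p) i

  _·_ : H → Stream → Stream
  h · p = (v₀ ∷ proj₁ h) ++ₛ p

  tailₛ : Stream → Stream
  tailₛ ρ i = ρ (suc i)

  IsStrictWeakOrder : (Stream → Stream → Set) → Set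
  IsStrictWeakOrder _≺_ =
    (∀ x → InfH x → ¬ (x ≺ x)) ×
    (∀ x y z → InfH x → InfH y → InfH z → x ≺ y → y ≺ z → x ≺ z) ×
    (∀ x y z → InfH x → InfH y → InfH z → ¬ (x ≺ y) → ¬ (y ≺ z) → ¬ (x ≺ z))

  record MooreDFA : Set where
    field
      states  : ℕ
      classes : ℕ
      start   : Fin states
      δ       : Fin states → V → Fin states
      out     : Fin states → Fin classes
    run : List V → Fin states
    run = foldl δ start

  -- ∼ is an equivalence relation on H with finitely many classes, decided by a
  -- finite automaton: the class of a history v₀ ∷ u is the output of a DFA on it.
  IsAutomaticEquiv : (H → H → Set) → Set
  IsAutomaticEquiv _∼_ =
    IsEquivalence _∼_ ×
    Σ MooreDFA (λ M → ∀ h h' →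
       (h ∼ h') ⇔ (MooreDFA.out M (MooreDFA.run M (v₀ ∷ proj₁ h))
                   ≡ MooreDFA.out M (MooreDFA.run M (v₀ ∷ proj₁ h'))))

  IsAutomaticPiecewisePrefixLinear : (Stream → Stream → Set) → (H → H → Set) → Set
  IsAutomaticPiecewisePrefixLinear _≺_ _∼_ =
    IsAutomaticEquiv _∼_ ×
    (∀ h h' → h ∼ h' → lastH h ≡ lastH h') ×
    (∀ h h' → h ∼ h' → ∀ p q →
       InfH (h · p) → InfH (h · q) → InfH (h' · p) → InfH (h' · q) →
       ((h · p) ≺ (h · q)) ⇔ ((h' · p) ≺ (h' · q)))

  -- strategies of player a in a future game starting at v₁: a map from finite
  -- paths v₁ ∷ u (given by u) ending in V_a to a successor vertex.
  record Strategy (a : A) (v₁ : V) : Set where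
    field
      move  : List V → V
      valid : ∀ u → IsPath v₁ u → owner (lastOf v₁ u) ≡ a → E (lastOf v₁ u) (move u)
  open Strategy public

  Compatible : A → V → (List V → V) → Stream → Set
  Compatible a v₁ mv ρ =
    InfPathFrom v₁ ρ ×
    (∀ i → owner (ρ i) ≡ a → ρ (suc i) ≡ mv (applyUpTo (tailₛ ρ) i))

  -- γ_a(h, s_a) as a predicate on infinite paths v₁p of g_h (p = tail)
  γ : A → H → (List V → V) → Stream → Set
  γ a h mv ρ =
    InfPathFrom (lastH h) ρ ×
    ∃ λ ρ' → Compatible a (lastH h) mv ρ' × ¬ pref a (h · tailₛ ρ) (h · tailₛ ρ')

  Γ : A → H → Stream → Set
  Γ a h ρ = ∀ (s : Strategy a (lastH h)) → γ a h (move s) ρ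

-- The guarantee γ_a(h, s_a) mentions h in two places only: through its last
-- vertex (the start of the future game g_h, which fixes the admissible plays
-- and the compatible plays of s_a) and through the comparisons h p ≺_a h p'.
-- We isolate exactly this dependence in the notion of two histories having
-- the *same prefix order*: equal last vertex, and the comparisons of their
-- extensions agree.  Prefix-linearity says h' ∼ h gives the same prefix order,
-- and the notion is symmetric.  Showing γ_a(k, ·) ⊆ γ_a(k', ·) for histories
-- with the same prefix order only needs that every play ρ of g_k yields an
-- infinite path k·(tail ρ) of the whole game (so that the comparisons are
-- covered by the hypothesis); by symmetry we get equality of the γ's.  For
-- Γ_a = ⋂ γ_a we additionally retarget strategies along the equality of last
-- vertices, which leaves their move functions unchanged.
module Submission where

open import Defs
open import Function.Bundles using (_⇔_; mk⇔; Equivalence)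
open import Function.Construct.Symmetry using (⇔-sym)
open import Data.Product using (_×_; _,_; proj₂)
open import Data.Nat using (zero; suc)
open import Data.List using (List; []; _∷_)
open import Relation.Nullary using (¬_)
open import Relation.Binary.PropositionalEquality using (_≡_; refl; sym; subst)

module _ (g : Game) where
  open Game g

  path-then-play : ∀ (v : V g) (u : List (V g)) (ρ : Stream g) → IsPath g v u →
                   InfPathFrom g (lastOf g v u) ρ →
                   InfPathFrom g v (_++ₛ_ g (v ∷ u) (tailₛ g ρ))
  path-then-play v []      ρ _           (ρ0≡v , edge) =
    refl , λ { zero → subst (λ x → E x (ρ 1)) ρ0≡v (edge 0) ; (suc i) → edge (suc i) }
  path-then-play v (w ∷ u) ρ (v→w , path) play =
    refl , λ { zero → v→w ; (suc i) → proj₂ (path-then-play w u ρ path play) i }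

  history-then-play : ∀ (k : H g) (ρ : Stream g) → InfPathFrom g (lastH g k) ρ →
                      InfH g (_·_ g k (tailₛ g ρ))
  history-then-play (u , path) ρ = path-then-play v₀ u ρ path

  record SamePrefixOrder (a : A) (k k' : H g) : Set where
    constructor same-prefix-order
    field
      same-last  : lastH g k ≡ lastH g k'
      same-order : ∀ p q → InfH g (_·_ g k p) → InfH g (_·_ g k q) →
                           InfH g (_·_ g k' p) → InfH g (_·_ g k' q) →
                           pref a (_·_ g k p) (_·_ g k q) ⇔ pref a (_·_ g k' p) (_·_ g k' q)

  same-prefix-order-sym : ∀ {a k k'} → SamePrefixOrder a k k' → SamePrefixOrder a k' k
  same-prefix-order-sym (same-prefix-order last≡ agree) = same-prefix-order
    (sym last≡) (λ p q k'p k'q kp kq → ⇔-sym (agree p q kp kq k'p k'q))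

  prefix-linear⇒same-prefix-order :
    ∀ {a} {_∼_ : H g → H g → Set} → IsAutomaticPiecewisePrefixLinear g (pref a) _∼_ →
    ∀ k k' → k ∼ k' → SamePrefixOrder a k k'
  prefix-linear⇒same-prefix-order (_ , last≡ , agree) k k' k∼k' =
    same-prefix-order (last≡ k k' k∼k') (agree k k' k∼k')

  γ-transfer : ∀ {a k k'} → SamePrefixOrder a k k' →
               ∀ mv ρ → γ g a k mv ρ → γ g a k' mv ρ
  γ-transfer {a} {k} {k'} (same-prefix-order last≡ agree) mv ρ
             (play , ρ' , (play' , follows) , k·ρ⊀k·ρ') =
    move-start play , ρ' , (move-start play' , follows) , k'·ρ⊀k'·ρ'
    where
      move-start : ∀ {σ} → InfPathFrom g (lastH g k) σ → InfPathFrom g (lastH g k') σ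
      move-start {σ} = subst (λ v → InfPathFrom g v σ) last≡

      k'·ρ⊀k'·ρ' : ¬ pref a (_·_ g k' (tailₛ g ρ)) (_·_ g k' (tailₛ g ρ'))
      k'·ρ⊀k'·ρ' k'·ρ≺k'·ρ' = k·ρ⊀k·ρ' (Equivalence.from
        (agree (tailₛ g ρ) (tailₛ g ρ')
               (history-then-play k ρ play) (history-then-play k ρ' play')
               (history-then-play k' ρ (move-start play))
               (history-then-play k' ρ' (move-start play')))
        k'·ρ≺k'·ρ')

  γ-same : ∀ {a k k'} → SamePrefixOrder a k k' →
           ∀ mv ρ → γ g a k mv ρ ⇔ γ g a k' mv ρ
  γ-same same mv ρ = mk⇔ (γ-transfer same mv ρ) (γ-transfer (same-prefix-order-sym same) mv ρ)

  retarget : ∀ {a} {v w : V g} → v ≡ w → Strategy g a w → Strategy g a v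
  retarget refl s = s

  move-retarget : ∀ {a} {v w : V g} (v≡w : v ≡ w) (s : Strategy g a w) →
                  Strategy.move (retarget v≡w s) ≡ Strategy.move s
  move-retarget refl s = refl

  -- The best guarantee is contained in that of any history with the same
  -- prefix order: each strategy of g_k' is also a strategy of g_k.
  Γ-transfer : ∀ {a k k'} → SamePrefixOrder a k k' → ∀ ρ → Γ g a k ρ → Γ g a k' ρ
  Γ-transfer {a} {k} {k'} same ρ best s =
    subst (λ mv → γ g a k' mv ρ) (move-retarget last≡ s)
          (γ-transfer same (Strategy.move (retarget last≡ s)) ρ (best (retarget last≡ s)))
    where
      last≡ : lastH g k ≡ lastH g k'
      last≡ = SamePrefixOrder.same-last same

  Γ-same : ∀ {a k k'} → SamePrefixOrder a k k' → ∀ ρ → Γ g a k ρ ⇔ Γ g a k' ρ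
  Γ-same same ρ = mk⇔ (Γ-transfer same ρ) (Γ-transfer (same-prefix-order-sym same) ρ)

lemma36 : (g : Game) (a : Game.A g) (_∼_ : H g → H g → Set) →
    IsStrictWeakOrder g (Game.pref g a) →
    IsAutomaticPiecewisePrefixLinear g (Game.pref g a) _∼_ →
    (h h' : H g) → h' ∼ h →
    ((s : Strategy g a (lastH g h)) → ∀ ρ → γ g a h (Strategy.move s) ρ ⇔ γ g a h' (Strategy.move s) ρ)
    × (∀ ρ → Γ g a h ρ ⇔ Γ g a h' ρ)
lemma36 g a _∼_ _ prefixLinear h h' h'∼h =
  (λ s → γ-same g same (Strategy.move s)) , Γ-same g same
  where
    same : SamePrefixOrder g a h h'
    same = same-prefix-order-sym g (prefix-linear⇒same-prefix-order g prefixLinear h' h h'∼h)
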